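{- Let $n\ge 4$ be even and let $p$ be an integer with $n\le p\le \frac{5n}{2}+3$. Then the $\infty$-digraph $C_n\cdot C_p$ admits a quasi-$\left(4,\frac{n}{2}+1\right)$-labeling.
   Context: All digraphs are finite. For integers $\alpha>0$, $k>1$, a quasi-$(\alpha,k)$-labeling of a digraph $D=(V,A)$ assigns to each vertex $x$ a string $(l_1(x),\dots,l_k(x))$ with entries in $\{1,\dots,\alpha\}$ such that distinct vertices receive distinct strings and, whenever $xy\in A$, $l_i(x)=l_{i-1}(y)$ for all $i\in\{2,\dots,k\}$. The $\infty$-digraph $C_n\cdot C_p$ is obtained from a directed cycle $C_n$ of length $n$ and a directed cycle $C_p$ of length $p$, otherwise vertex-disjoint, by identifying one vertex of $C_n$ with one vertex of $C_p$. -}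

module Defs where

open import Data.Nat using (ℕ; zero; suc; _+_; _∸_; _<_; _≤_)
open import Data.Fin using (Fin; toℕ; inject₁) renaming (suc to fsuc)
open import Data.Vec using (Vec; lookup)
open import Data.Product using (Σ; _×_)
open import Data.Sum using (_⊎_)
open import Relation.Binary.PropositionalEquality using (_≡_)
open import Function.Definitions using (Injective)

record Digraph : Set₁ where
  field
    order : ℕ
    Arc   : Fin order → Fin order → Set
open Digraph public

-- Strings (l_1,…,l_k) are vectors of length k over
-- Fin α (Fin α ≅ {1,…,α}); positions are 0-indexed, so position j stands for l_{j+1}.
-- The arc condition l_i(x) = l_{i-1}(y) for i ∈ {2,…,k} becomes
-- lookup (l x) (suc j) ≡ lookup (l y) (inject₁ j) for all j : Fin (k-1), with k = suc m.
record QuasiLabeling (α m : ℕ) (D : Digraph) : Set where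
  field
    label     : Fin (order D) → Vec (Fin α) (suc m)
    distinct  : Injective _≡_ _≡_ label
    arcs      : ∀ x y → Arc D x y → ∀ (j : Fin m) →
                lookup (label x) (fsuc j) ≡ lookup (label y) (inject₁ j)

-- Arc relation of C_n · C_p on vertices {0,…,n+p-2} (given as natural numbers):
-- vertex 0 is the common vertex; C_n is 0 → 1 → ⋯ → n-1 → 0 and
-- C_p is 0 → n → n+1 → ⋯ → n+p-2 → 0.
data InfArc (n p : ℕ) : ℕ → ℕ → Set where
  cn-step  : ∀ i → suc i < n → InfArc n p i (suc i)
  cn-close : InfArc n p (n ∸ 1) 0
  cp-enter : InfArc n p 0 n
  cp-step  : ∀ i → n ≤ i → suc i ≤ n + p ∸ 2 → InfArc n p i (suc i)
  cp-close : InfArc n p (n + p ∸ 2) 0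

infinityDigraph : ℕ → ℕ → Digraph
infinityDigraph n p = record
  { order = n + p ∸ 1
  ; Arc   = λ x y → InfArc n p (toℕ x) (toℕ y)
  }

module Submission where

open import Defs
open import Data.Nat using (ℕ; _+_; _*_; _/_; _≤_)
open import Data.Nat.Divisibility using (_∣_)

open import Data.Nat using (zero; suc; pred; _∸_; _<_; z≤n; s≤s; NonZero; >-nonZero; _<?_)
open import Data.Nat.Properties
open import Data.Nat.DivMod using (_%_; m<n⇒m%n≡m; [m+n]%n≡m%n; m*n/n≡m)
open import Data.Nat.Divisibility using (divides)
open import Data.Nat.Tactic.RingSolver using (solve-∀)
open import Data.Fin using (Fin; toℕ; inject₁) renaming (zero to fzero; suc to fsuc)
open import Data.Fin.Properties using (toℕ-injective; toℕ-inject₁; toℕ<n) renaming (_≟_ to _≟ᶠ_)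
open import Data.List using (List; []; _∷_; _++_; replicate; applyUpTo; foldr)
open import Data.List.Relation.Unary.All using (All; []; _∷_)
open import Data.List.Relation.Unary.All.Properties using (applyUpTo⁺₁)
open import Data.Vec using (Vec; tabulate; toList; lookup)
open import Data.Vec.Properties using (lookup∘tabulate)
open import Data.Product using (Σ-syntax; _×_; _,_; proj₁)
open import Data.Sum using (_⊎_; inj₁; inj₂)
open import Data.Unit using (⊤; tt)
open import Function using (_∘′_)
open import Relation.Nullary using (yes; no; contradiction)
open import Relation.Binary.Definitions using (DecidableEquality)
open import Relation.Binary.PropositionalEquality
open ≡-Reasoning

-- Every label is a window of length k = m + 1 of a cyclic word over {0,1,2,3}:
--   * vertex t < n of C_n gets the window at position t of A = 0ᵐ 1ᵐ (period n);
--   * vertex n + s of C_p gets the window at position s + 1 of U = 0ᵐ 1 W (period p), where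
--     W = 2ᵏ 3ᵏ 2 3ᵐ⁻¹ 2 2 2 ⋯ is cut so that U has length p.
-- Along every arc the head reads one position further than the tail, and the common vertex 0
-- is consistent because A and U both begin with 0ᵐ 1: this is the arc condition.  Labels are
-- distinct because the run-length encoding of a window determines its vertex.  The bound
-- p ≤ 5m + 3 ensures that no window lies inside the final block of 2s of W (it would repeat 2ᵏ).

module _ {A : Set} where

  applyUpTo-++ : ∀ (f : ℕ → A) a b → applyUpTo f (a + b) ≡ applyUpTo f a ++ applyUpTo (λ j → f (a + j)) b
  applyUpTo-++ f zero    b = refl
  applyUpTo-++ f (suc a) b = cong (f 0 ∷_) (applyUpTo-++ (λ j → f (suc j)) a b)

  applyUpTo-cong : ∀ (f g : ℕ → A) a → (∀ j → j < a → f j ≡ g j) → applyUpTo f a ≡ applyUpTo g a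
  applyUpTo-cong f g zero    eq = refl
  applyUpTo-cong f g (suc a) eq =
    cong₂ _∷_ (eq 0 (s≤s z≤n)) (applyUpTo-cong (λ j → f (suc j)) (λ j → g (suc j)) a (λ j j<a → eq (suc j) (s≤s j<a)))

  applyUpTo-const : ∀ (f : ℕ → A) a c → (∀ j → j < a → f j ≡ c) → applyUpTo f a ≡ replicate a c
  applyUpTo-const f zero    c h = refl
  applyUpTo-const f (suc a) c h =
    cong₂ _∷_ (h 0 (s≤s z≤n)) (applyUpTo-const (λ j → f (suc j)) a c (λ j j<a → h (suc j) (s≤s j<a)))

  toList-tabulate : ∀ k (f : ℕ → A) → toList (tabulate {n = k} (λ j → f (toℕ j))) ≡ applyUpTo f k
  toList-tabulate zero    f = refl
  toList-tabulate (suc k) f = cong (f 0 ∷_) (toList-tabulate k (λ j → f (suc j)))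

windowLabeling : ∀ {α m} (D : Digraph) (letter : ℕ → ℕ → Fin α) (decode : List (Fin α) → ℕ) →
  (∀ x y → Arc D x y → ∀ j → j < m → letter (toℕ x) (suc j) ≡ letter (toℕ y) j) →
  (∀ x → decode (applyUpTo (letter (toℕ x)) (suc m)) ≡ toℕ x) →
  QuasiLabeling α m D
windowLabeling {α} {m} D letter decode shift decodes = record
  { label    = label
  ; distinct = λ {x} {y} same → toℕ-injective (begin
      toℕ x                      ≡⟨ sym (decoded x) ⟩
      decode (toList (label x))  ≡⟨ cong (decode ∘′ toList) same ⟩
      decode (toList (label y))  ≡⟨ decoded y ⟩
      toℕ y                      ∎)
  ; arcs     = λ x y arc j → begin
      lookup (label x) (fsuc j)        ≡⟨ lookup∘tabulate (letter (toℕ x) ∘′ toℕ) (fsuc j) ⟩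
      letter (toℕ x) (suc (toℕ j))     ≡⟨ shift x y arc (toℕ j) (toℕ<n j) ⟩
      letter (toℕ y) (toℕ j)           ≡⟨ cong (letter (toℕ y)) (sym (toℕ-inject₁ j)) ⟩
      letter (toℕ y) (toℕ (inject₁ j)) ≡⟨ sym (lookup∘tabulate (letter (toℕ y) ∘′ toℕ) (inject₁ j)) ⟩
      lookup (label y) (inject₁ j)     ∎
  }
  where
  label : Fin (order D) → Vec (Fin α) (suc m)
  label x = tabulate (λ j → letter (toℕ x) (toℕ j))
  decoded : ∀ x → decode (toList (label x)) ≡ toℕ x
  decoded x = trans (cong decode (toList-tabulate (suc m) (letter (toℕ x)))) (decodes x)

module _ {A : Set} where

  cyclic : (p : ℕ) .{{_ : NonZero p}} → (ℕ → A) → ℕ → A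
  cyclic p w x = w (x % p)

  cyclic-< : ∀ p .{{_ : NonZero p}} (w : ℕ → A) {x} → x < p → cyclic p w x ≡ w x
  cyclic-< p w x<p = cong w (m<n⇒m%n≡m x<p)

  cyclic-period : ∀ p .{{_ : NonZero p}} (w : ℕ → A) x → cyclic p w (p + x) ≡ cyclic p w x
  cyclic-period p w x = cong w (trans (cong (_% p) (+-comm p x)) ([m+n]%n≡m%n x p))

module RunLength {A : Set} (_≟_ : DecidableEquality A) where

  Run : Set
  Run = A × ℕ

  expand : List Run → List A
  expand []            = []
  expand ((c , a) ∷ R) = replicate a c ++ expand R

  runLength : List Run → ℕ
  runLength []            = 0
  runLength ((_ , a) ∷ R) = a + runLength R

  Fresh : A → List Run → Set
  Fresh c []             = ⊤
  Fresh c ((c' , _) ∷ _) = c ≢ c'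

  Normal : List Run → Set
  Normal []            = ⊤
  Normal ((c , a) ∷ R) = 0 < a × Fresh c R × Normal R

  lastRun : Run → List Run → Run
  lastRun r []       = r
  lastRun _ (r ∷ R)  = lastRun r R

  lastRun-snoc : ∀ r R z → lastRun r (R ++ z ∷ []) ≡ z
  lastRun-snoc r []       z = refl
  lastRun-snoc r (r' ∷ R) z = lastRun-snoc r' R z

  push : A → List Run → List Run
  push x [] = (x , 1) ∷ []
  push x ((y , a) ∷ R) with x ≟ y
  ... | yes _ = (y , suc a) ∷ R
  ... | no  _ = (x , 1) ∷ (y , a) ∷ R

  rle : List A → List Run
  rle = foldr push []

  push-same : ∀ c a R → push c ((c , a) ∷ R) ≡ (c , suc a) ∷ R
  push-same c a R with c ≟ c
  ... | yes _   = refl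
  ... | no  c≢c = contradiction refl c≢c

  push-fresh : ∀ c R → Fresh c R → push c R ≡ (c , 1) ∷ R
  push-fresh c []            _   = refl
  push-fresh c ((c' , a) ∷ R) c≢c' with c ≟ c'
  ... | yes c≡c' = contradiction c≡c' c≢c'
  ... | no  _    = refl

  -- push only inspects the first run.
  push-++ : ∀ x y a R S → push x ((y , a) ∷ R ++ S) ≡ push x ((y , a) ∷ R) ++ S
  push-++ x y a R S with x ≟ y
  ... | yes _ = refl
  ... | no  _ = refl

  rle-head : ∀ x xs → Σ[ a ∈ ℕ ] Σ[ R ∈ List Run ] rle (x ∷ xs) ≡ (x , suc a) ∷ R
  rle-head x xs with rle xs
  ... | []           = 0 , [] , refl
  ... | (y , a) ∷ R with x ≟ y
  ...   | yes refl = a , R , refl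
  ...   | no  _    = 0 , (y , a) ∷ R , refl

  rle-prepend : ∀ a c xs → Fresh c (rle xs) → rle (replicate (suc a) c ++ xs) ≡ (c , suc a) ∷ rle xs
  rle-prepend zero    c xs fresh = push-fresh c (rle xs) fresh
  rle-prepend (suc a) c xs fresh = trans (cong (push c) (rle-prepend a c xs fresh)) (push-same c (suc a) (rle xs))

  rle-expand : ∀ R → Normal R → rle (expand R) ≡ R
  rle-expand []                _                    = refl
  rle-expand ((c , suc a) ∷ R) (_ , fresh , normal) =
    trans (rle-prepend a c (expand R) (subst (Fresh c) (sym (rle-expand R normal)) fresh))
          (cong ((c , suc a) ∷_) (rle-expand R normal))

  rle-replicate : ∀ b c → rle (replicate (suc b) c) ≡ (c , suc b) ∷ []
  rle-replicate zero    c = refl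
  rle-replicate (suc b) c = trans (cong (push c) (rle-replicate b c)) (push-same c (suc b) [])

  rle-append : ∀ xs b c → All (_≢ c) xs → rle (xs ++ replicate (suc b) c) ≡ rle xs ++ (c , suc b) ∷ []
  rle-append []       b c []           = rle-replicate b c
  rle-append (x ∷ xs) b c (x≢c ∷ none) with rle xs | rle-append xs b c none
  ... | []          | eq = trans (cong (push x) eq) (push-fresh x _ x≢c)
  ... | (y , a) ∷ R | eq = trans (cong (push x) eq) (push-++ x y a R _)

  Spells : (ℕ → A) → List Run → Set
  Spells f []            = ⊤
  Spells f ((c , a) ∷ R) = (∀ j → j < a → f j ≡ c) × Spells (λ j → f (a + j)) R

  spells-expand : ∀ f R → Spells f R → applyUpTo f (runLength R) ≡ expand R
  spells-expand f []            _            = refl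
  spells-expand f ((c , a) ∷ R) (const , rest) =
    trans (applyUpTo-++ f a (runLength R))
          (cong₂ _++_ (applyUpTo-const f a c const) (spells-expand (λ j → f (a + j)) R rest))

  spells-cong : ∀ {f g} R → (∀ j → j < runLength R → f j ≡ g j) → Spells g R → Spells f R
  spells-cong []            _  _              = tt
  spells-cong ((c , a) ∷ R) eq (const , rest) =
    (λ j j<a → trans (eq j (<-≤-trans j<a (m≤m+n a _))) (const j j<a)) ,
    spells-cong R (λ j j<R → eq (a + j) (+-monoʳ-< a j<R)) rest

  spells-++ : ∀ f S S' → Spells f S → Spells (λ j → f (runLength S + j)) S' → Spells f (S ++ S')
  spells-++ f []            S' _               rest  = rest
  spells-++ f ((c , a) ∷ S) S' (const , spells) rest =
    const , spells-++ (λ j → f (a + j)) S S' spells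
              (spells-cong S' (λ j _ → cong f (sym (+-assoc a (runLength S) j))) rest)

  -- The infinite word  expand R · d d d ⋯ .
  letterAt : A → List Run → ℕ → A
  letterAt d []                  x       = d
  letterAt d ((c , zero)  ∷ R)   x       = letterAt d R x
  letterAt d ((c , suc a) ∷ R)   zero    = c
  letterAt d ((c , suc a) ∷ R)   (suc x) = letterAt d ((c , a) ∷ R) x

  letterAt-run : ∀ d c a R x → x < a → letterAt d ((c , a) ∷ R) x ≡ c
  letterAt-run d c (suc a) R zero    _         = refl
  letterAt-run d c (suc a) R (suc x) (s≤s x<a) = letterAt-run d c a R x x<a

  letterAt-drop : ∀ d c o a R x → o ≤ a → letterAt d ((c , a) ∷ R) (o + x) ≡ letterAt d ((c , a ∸ o) ∷ R) x
  letterAt-drop d c zero    a       R x _         = refl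
  letterAt-drop d c (suc o) (suc a) R x (s≤s o≤a) = letterAt-drop d c o a R x o≤a

  letterAt-skip : ∀ d c a R x → letterAt d ((c , a) ∷ R) (a + x) ≡ letterAt d R x
  letterAt-skip d c zero    R x = refl
  letterAt-skip d c (suc a) R x = letterAt-skip d c a R x

  letterAt-All : ∀ {P : A → Set} d R → P d → All (λ r → P (proj₁ r)) R → ∀ x → P (letterAt d R x)
  letterAt-All d []                Pd _          x       = Pd
  letterAt-All d ((c , zero)  ∷ R) Pd (_  ∷ PR)  x       = letterAt-All d R Pd PR x
  letterAt-All d ((c , suc a) ∷ R) Pd (Pc ∷ PR)  zero    = Pc
  letterAt-All d ((c , suc a) ∷ R) Pd (Pc ∷ PR)  (suc x) = letterAt-All d ((c , a) ∷ R) Pd (Pc ∷ PR) x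

  -- S describes an initial segment of the word  expand R · d d d ⋯ .
  data Prefix (d : A) : List Run → List Run → Set where
    done    : ∀ {R} → Prefix d [] R
    default : ∀ {b} → Prefix d ((d , b) ∷ []) []
    part    : ∀ {c a b R} → b ≤ a → Prefix d ((c , b) ∷ []) ((c , a) ∷ R)
    whole   : ∀ {c a S R} → Prefix d S R → Prefix d ((c , a) ∷ S) ((c , a) ∷ R)

  prefix-spells : ∀ {d S R} → Prefix d S R → Spells (letterAt d R) S
  prefix-spells done = tt
  prefix-spells default = (λ _ _ → refl) , tt
  prefix-spells {d} {R = (c , a) ∷ R} (part b≤a) =
    (λ j j<b → letterAt-run d c a R j (<-≤-trans j<b b≤a)) , tt
  prefix-spells {d} {(c , a) ∷ S} {(c , a) ∷ R} (whole prefix) =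
    (λ j → letterAt-run d c a R j) ,
    spells-cong S (λ j _ → letterAt-skip d c a R j) (prefix-spells prefix)

  spells-wrap : ∀ p .{{_ : NonZero p}} w x S S' → x + runLength S ≡ p → runLength S' ≤ p →
    Spells (λ j → w (x + j)) S → Spells w S' → Spells (λ j → cyclic p w (x + j)) (S ++ S')
  spells-wrap p w x S S' end short before after =
    spells-++ _ S S'
      (spells-cong S (λ j j<S → cyclic-< p w (subst (x + j <_) end (+-monoʳ-< x j<S))) before)
      (spells-cong S' (λ j j<S' → trans (cong (cyclic p w) (trans (sym (+-assoc x _ j)) (cong (_+ j) end)))
                                   (trans (cyclic-period p w j) (cyclic-< p w (<-≤-trans j<S' short)))) after)

F4 : Set
F4 = Fin 4

pattern c0 = fzero
pattern c1 = fsuc fzero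
pattern c2 = fsuc (fsuc fzero)
pattern c3 = fsuc (fsuc (fsuc fzero))

open RunLength (_≟ᶠ_ {4})

module Construction (m p : ℕ) (2≤m : 2 ≤ m) (n≤p : m + m ≤ p) where

  n k : ℕ
  n = m + m
  k = suc m

  m<n : m < n
  m<n = m<m+n m (≤-trans (s≤s z≤n) 2≤m)

  m<p : m < p
  m<p = <-≤-trans m<n n≤p

  0<n : 0 < n
  0<n = ≤-<-trans z≤n m<n

  ∸-+-cancel : ∀ x j {o} → o ≤ x → x ∸ o + (o + j) ≡ x + j
  ∸-+-cancel x j {o} o≤x = trans (sym (+-assoc (x ∸ o) o j)) (cong (_+ j) (m∸n+n≡m o≤x))

  instance
    m-nonZero : NonZero m
    m-nonZero = >-nonZero (≤-trans (s≤s z≤n) 2≤m)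
    n-nonZero : NonZero n
    n-nonZero = >-nonZero (≤-<-trans z≤n m<n)
    p-nonZero : NonZero p
    p-nonZero = >-nonZero (≤-<-trans z≤n m<p)

  -- C_n reads the cyclic word A = 0ᵐ 1ᵐ.
  aLetters : ℕ → F4
  aLetters = letterAt c1 ((c0 , m) ∷ [])

  aWord : ℕ → F4
  aWord = cyclic n aLetters

  wTail : List Run
  wTail = (c2 , 1) ∷ (c3 , pred m) ∷ []

  wRuns : List Run
  wRuns = (c2 , k) ∷ (c3 , k) ∷ wTail

  wWord : ℕ → F4
  wWord = letterAt c2 wRuns

  -- C_p reads the cyclic word U = 0ᵐ 1 W, cut to length p.
  uRuns : List Run
  uRuns = (c0 , m) ∷ (c1 , 1) ∷ wRuns

  uLetters : ℕ → F4
  uLetters = letterAt c2 uRuns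

  uWord : ℕ → F4
  uWord = cyclic p uLetters

  letter : ℕ → ℕ → F4
  letter t j with t <? n
  ... | yes _ = aWord (t + j)
  ... | no  _ = uWord (t ∸ n + suc j)

  letter-A : ∀ {t} j → t < n → letter t j ≡ aWord (t + j)
  letter-A {t} j t<n with t <? n
  ... | yes _   = refl
  ... | no  t≮n = contradiction t<n t≮n

  letter-U : ∀ {t} j → n ≤ t → letter t j ≡ uWord (t ∸ n + suc j)
  letter-U {t} j n≤t with t <? n
  ... | yes t<n = contradiction n≤t (<⇒≱ t<n)
  ... | no  _   = refl

  -- Both words start with 0ᵐ 1, so the common vertex 0 is labeled consistently.
  words-agree : ∀ {x} → x ≤ m → aWord x ≡ uWord x
  words-agree {x} x≤m with m≤n⇒m<n∨m≡n x≤m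
  ... | inj₁ x<m = begin
    aWord x                      ≡⟨ cyclic-< n aLetters (<-trans x<m m<n) ⟩
    aLetters x                   ≡⟨ letterAt-run c1 c0 m [] x x<m ⟩
    c0                           ≡⟨ sym (letterAt-run c2 c0 m _ x x<m) ⟩
    letterAt c2 uRuns x          ≡⟨ sym (cyclic-< p uLetters (<-trans x<m m<p)) ⟩
    uWord x                      ∎
  ... | inj₂ refl = begin
    aWord m                             ≡⟨ cyclic-< n aLetters m<n ⟩
    aLetters m                          ≡⟨ cong aLetters m≡m+0 ⟩
    aLetters (m + 0)                    ≡⟨ letterAt-skip c1 c0 m [] 0 ⟩
    c1                                  ≡⟨ sym (letterAt-skip c2 c0 m ((c1 , 1) ∷ wRuns) 0) ⟩
    letterAt c2 uRuns (m + 0)           ≡⟨ cong (letterAt c2 uRuns) (sym m≡m+0) ⟩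
    letterAt c2 uRuns m                 ≡⟨ sym (cyclic-< p uLetters m<p) ⟩
    uWord m                             ∎
    where
      m≡m+0 : m ≡ m + 0
      m≡m+0 = sym (+-identityʳ m)

  shift : ∀ a b → InfArc n p a b → ∀ j → j < m → letter a (suc j) ≡ letter b j
  shift a b (cn-step i i+1<n) j _ = begin
    letter i (suc j)    ≡⟨ letter-A (suc j) (<-trans (n<1+n i) i+1<n) ⟩
    aWord (i + suc j)   ≡⟨ cong aWord (+-suc i j) ⟩
    aWord (suc i + j)   ≡⟨ sym (letter-A j i+1<n) ⟩
    letter (suc i) j    ∎
  shift a b cn-close j _ = begin
    letter (n ∸ 1) (suc j)  ≡⟨ letter-A (suc j) (∸-monoʳ-< {n} {1} {0} (s≤s z≤n) 0<n) ⟩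
    aWord (n ∸ 1 + suc j)   ≡⟨ cong aWord (∸-+-cancel n j 0<n) ⟩
    aWord (n + j)           ≡⟨ cyclic-period n aLetters j ⟩
    aWord j                 ≡⟨ sym (letter-A j 0<n) ⟩
    letter 0 j              ∎
  shift a b cp-enter j j<m = begin
    letter 0 (suc j)        ≡⟨ letter-A (suc j) 0<n ⟩
    aWord (suc j)           ≡⟨ words-agree j<m ⟩
    uWord (suc j)           ≡⟨ cong (λ s → uWord (s + suc j)) (sym (n∸n≡0 n)) ⟩
    uWord (n ∸ n + suc j)   ≡⟨ sym (letter-U j ≤-refl) ⟩
    letter n j              ∎
  shift a b (cp-step i n≤i _) j _ = begin
    letter i (suc j)              ≡⟨ letter-U (suc j) n≤i ⟩
    uWord (i ∸ n + suc (suc j))   ≡⟨ cong uWord (+-suc (i ∸ n) (suc j)) ⟩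
    uWord (suc (i ∸ n) + suc j)   ≡⟨ cong (λ s → uWord (s + suc j)) (sym (+-∸-assoc 1 n≤i)) ⟩
    uWord (suc i ∸ n + suc j)     ≡⟨ sym (letter-U j (≤-trans n≤i (n≤1+n i))) ⟩
    letter (suc i) j              ∎
  shift a b cp-close j j<m = begin
    letter (n + p ∸ 2) (suc j)             ≡⟨ letter-U (suc j) n≤n+p∸2 ⟩
    uWord (n + p ∸ 2 ∸ n + suc (suc j))    ≡⟨ cong (λ s → uWord (s + suc (suc j))) last-of-Cp ⟩
    uWord (p ∸ 2 + suc (suc j))            ≡⟨ cong uWord (∸-+-cancel p j 2≤p) ⟩
    uWord (p + j)                          ≡⟨ cyclic-period p uLetters j ⟩
    uWord j                                ≡⟨ sym (words-agree (<⇒≤ j<m)) ⟩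
    aWord j                                ≡⟨ sym (letter-A j 0<n) ⟩
    letter 0 j                             ∎
    where
      2≤p : 2 ≤ p
      2≤p = ≤-trans (≤-trans 2≤m (m≤m+n m m)) n≤p
      last-of-Cp : n + p ∸ 2 ∸ n ≡ p ∸ 2
      last-of-Cp = trans (cong (_∸ n) (+-∸-assoc n 2≤p)) (m+n∸m≡n n (p ∸ 2))
      n≤n+p∸2 : n ≤ n + p ∸ 2
      n≤n+p∸2 = subst (n ≤_) (sym (+-∸-assoc n 2≤p)) (m≤m+n n (p ∸ 2))

  -- Labels are decoded from their run-length encoding.  Vertex tailBase + c (c ≥ 1) reads the
  -- end of W followed by c letters 0.
  tailBase : ℕ
  tailBase = n + p ∸ (m + 2)

  -- Starting position in W of a window of W, recovered from its runs (cf. wWindow).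
  wPosition : List Run → ℕ
  wPosition ((c2 , _) ∷ [])                           = 0
  wPosition ((c2 , _) ∷ (c3 , b) ∷ [])                = b
  wPosition ((c3 , _) ∷ [])                           = k + 0
  wPosition ((c3 , _) ∷ (c2 , 1) ∷ [])                = k + 1
  wPosition ((c3 , _) ∷ (c2 , 1) ∷ (c3 , b) ∷ [])     = k + suc b
  wPosition ((c2 , _) ∷ (c3 , _) ∷ (c2 , _) ∷ [])     = k + (k + 0)
  wPosition ((c3 , _) ∷ (c2 , suc b) ∷ [])            = k + (k + b)
  wPosition _                                         = 0

  -- The decoder, given the first run, the remaining runs and the last run of a label:
  --   0ᵃ 1ᵇ ↦ b - 1,  1ᵃ 0ᵇ ↦ m + b - 1,  0ᵃ 1 2ᵇ ↦ n + b - 1,  1 2ᵃ ⋯ ↦ n + m - 1,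
  --   a window starting in W and ending in 0ᶜ ↦ tailBase + c,  a window of W ↦ n + m + its position.
  decodeRuns : Run → List Run → Run → ℕ
  decodeRuns (c0 , _) ((c1 , b) ∷ [])             _       = pred b
  decodeRuns (c1 , _) ((c0 , b) ∷ [])             _       = m + pred b
  decodeRuns (c0 , _) ((c1 , _) ∷ (c2 , b) ∷ [])  _       = n + pred b
  decodeRuns (c1 , _) _                           _       = n + pred m
  decodeRuns (c2 , _) _                           (c0 , c) = tailBase + c
  decodeRuns (c3 , _) _                           (c0 , c) = tailBase + c
  decodeRuns r        R                           _       = n + (m + wPosition (r ∷ R))

  decode : List Run → ℕ
  decode []      = 0
  decode (r ∷ R) = decodeRuns r R (lastRun r R)

  Decodes : ℕ → Set
  Decodes t = decode (rle (applyUpTo (letter t) k)) ≡ t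

  decodes-via : ∀ t g S → (∀ j → j < k → letter t j ≡ g j) → Spells g S → runLength S ≡ k →
    Normal S → decode S ≡ t → Decodes t
  decodes-via t g S same spells length normal decoded = begin
    decode (rle (applyUpTo (letter t) k))         ≡⟨ cong (decode ∘′ rle) (applyUpTo-cong (letter t) g k same) ⟩
    decode (rle (applyUpTo g k))                  ≡⟨ cong (λ l → decode (rle (applyUpTo g l))) (sym length) ⟩
    decode (rle (applyUpTo g (runLength S)))      ≡⟨ cong (decode ∘′ rle) (spells-expand g S spells) ⟩
    decode (rle (expand S))                       ≡⟨ cong decode (rle-expand S normal) ⟩
    decode S                                      ≡⟨ decoded ⟩
    t                                             ∎

  runs-fill : ∀ {a b} → b ≤ a → a ∸ b + (b + 0) ≡ a
  runs-fill {a} {b} b≤a = trans (cong (a ∸ b +_) (+-identityʳ b)) (m∸n+n≡m b≤a)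

  letter-Cp : ∀ s j → letter (n + s) j ≡ uWord (suc s + j)
  letter-Cp s j = trans (letter-U j (m≤m+n n s))
                        (cong uWord (trans (cong (_+ suc j) (m+n∸m≡n n s)) (+-suc s j)))

  decodes-A₀ : ∀ t → t < m → Decodes t
  decodes-A₀ t t<m = decodes-via t (λ j → aLetters (t + j)) ((c0 , m ∸ t) ∷ (c1 , suc t) ∷ [])
    (λ j j<k → trans (letter-A j t<n) (cyclic-< n aLetters (+-mono-<-≤ t<m (≤-pred j<k))))
    (spells-cong _ (λ j _ → letterAt-drop c1 c0 t m [] j (<⇒≤ t<m)) (prefix-spells (whole default)))
    (runs-fill (s≤s (<⇒≤ t<m)))
    (m<n⇒0<n∸m t<m , (λ ()) , s≤s z≤n , tt , tt)
    refl
    where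
    t<n : t < n
    t<n = <-trans t<m m<n

  decodes-A₁ : ∀ d → d < m → Decodes (m + d)
  decodes-A₁ d d<m = decodes-via (m + d) (λ j → aWord (m + d + j)) ((c1 , m ∸ d) ∷ (c0 , suc d) ∷ [])
    (λ j _ → letter-A j (+-monoʳ-< m d<m))
    (spells-wrap n aLetters (m + d) ((c1 , m ∸ d) ∷ []) ((c0 , suc d) ∷ [])
      (trans (cong (m + d +_) (+-identityʳ (m ∸ d))) (trans (+-assoc m d _) (cong (m +_) (m+[n∸m]≡n (<⇒≤ d<m)))))
      (≤-trans (≤-reflexive (+-identityʳ (suc d))) (≤-trans d<m (<⇒≤ m<n)))
      ((λ j _ → trans (cong aLetters (+-assoc m d j)) (letterAt-skip c1 c0 m [] (d + j))) , tt)
      (prefix-spells (part d<m)))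
    (runs-fill (s≤s (<⇒≤ d<m)))
    (m<n⇒0<n∸m d<m , (λ ()) , s≤s z≤n , tt , tt)
    refl

  decodes-U₀ : ∀ s → suc s < m → Decodes (n + s)
  decodes-U₀ s s+1<m = decodes-via (n + s) (λ j → uLetters (suc s + j))
    ((c0 , m ∸ suc s) ∷ (c1 , 1) ∷ (c2 , suc s) ∷ [])
    (λ j j<k → trans (letter-Cp s j) (cyclic-< p uLetters (<-≤-trans (+-mono-<-≤ s+1<m (≤-pred j<k)) n≤p)))
    (spells-cong _ (λ j _ → letterAt-drop c2 c0 (suc s) m _ j (<⇒≤ s+1<m))
      (prefix-spells (whole (whole (part (≤-trans (<⇒≤ s+1<m) (n≤1+n m)))))))
    (runs-fill (≤-trans s+1<m (n≤1+n m)))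
    (m<n⇒0<n∸m s+1<m , (λ ()) , s≤s z≤n , (λ ()) , s≤s z≤n , tt , tt)
    refl

  decodes-U₁ : ∀ s → suc s ≡ m → Decodes (n + s)
  decodes-U₁ s refl with m≤n⇒m<n∨m≡n n≤p
  ... | inj₁ n<p = decodes-via (n + s) (λ j → uLetters (m + j)) ((c1 , 1) ∷ (c2 , m) ∷ [])
    (λ j j<k → trans (letter-Cp s j) (cyclic-< p uLetters (≤-<-trans (+-monoʳ-≤ m (≤-pred j<k)) n<p)))
    (spells-cong _ (λ j _ → letterAt-skip c2 c0 m _ j) (prefix-spells (whole (part (n≤1+n m)))))
    (cong suc (+-identityʳ m))
    (s≤s z≤n , (λ ()) , s≤s z≤n , tt , tt)
    refl
  ... | inj₂ n≡p = decodes-via (n + s) (λ j → uWord (m + j)) ((c1 , 1) ∷ (c2 , s) ∷ (c0 , 1) ∷ [])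
    (λ j _ → letter-Cp s j)
    (spells-wrap p uLetters m ((c1 , 1) ∷ (c2 , s) ∷ []) ((c0 , 1) ∷ [])
      (trans (cong (m +_) (cong suc (+-identityʳ s))) n≡p)
      (≤-trans (s≤s z≤n) (<⇒≤ m<p))
      (spells-cong _ (λ j _ → letterAt-skip c2 c0 m _ j) (prefix-spells (whole (part (m≤n⇒m≤1+n (n≤1+n s))))))
      (prefix-spells (part (s≤s z≤n))))
    (cong suc (trans (+-suc s 0) (cong suc (+-identityʳ s))))
    (s≤s z≤n , (λ ()) , 0<s , (λ ()) , s≤s z≤n , tt , tt)
    refl
    where
    0<s : 0 < s
    0<s = ≤-pred 2≤m

  WWindow : ℕ → Set
  WWindow r = Σ[ S ∈ List Run ] Spells (λ j → wWord (r + j)) S × runLength S ≡ k × Normal S × decode S ≡ n + (m + r)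

  wWord-after₁ : ∀ e j → wWord (k + e + j) ≡ letterAt c2 ((c3 , k) ∷ wTail) (e + j)
  wWord-after₁ e j = trans (cong wWord (+-assoc k e j)) (letterAt-skip c2 c2 k _ (e + j))

  wWord-after₂ : ∀ i j → wWord (k + (k + i) + j) ≡ letterAt c2 wTail (i + j)
  wWord-after₂ i j = begin
    wWord (k + (k + i) + j)                     ≡⟨ wWord-after₁ (k + i) j ⟩
    letterAt c2 ((c3 , k) ∷ wTail) (k + i + j)  ≡⟨ cong (letterAt c2 ((c3 , k) ∷ wTail)) (+-assoc k i j) ⟩
    letterAt c2 ((c3 , k) ∷ wTail) (k + (i + j)) ≡⟨ letterAt-skip c2 c3 k wTail (i + j) ⟩
    letterAt c2 wTail (i + j)                   ∎

  wWindow-late : ∀ i → i < m → WWindow (k + (k + i))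
  wWindow-late zero _ = (c2 , 1) ∷ (c3 , pred m) ∷ (c2 , 1) ∷ [] ,
    spells-cong _ (λ j _ → wWord-after₂ 0 j) (prefix-spells (whole (whole default))) ,
    cong suc (trans (+-comm (pred m) 1) (suc-pred m)) ,
    (s≤s z≤n , (λ ()) , <⇒≤pred 2≤m , (λ ()) , s≤s z≤n , tt , tt) ,
    refl
  wWindow-late (suc i) i<m = (c3 , pred m ∸ i) ∷ (c2 , suc (suc i)) ∷ [] ,
    spells-cong _ (λ j _ → trans (wWord-after₂ (suc i) j) (letterAt-drop c2 c3 i (pred m) [] j (<⇒≤ i<pred)))
      (prefix-spells (whole default)) ,
    (begin
      pred m ∸ i + (suc (suc i) + 0)   ≡⟨ +-suc (pred m ∸ i) (suc i + 0) ⟩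
      suc (pred m ∸ i + (suc i + 0))   ≡⟨ cong suc (+-suc (pred m ∸ i) (i + 0)) ⟩
      suc (suc (pred m ∸ i + (i + 0))) ≡⟨ cong (suc ∘′ suc) (runs-fill (<⇒≤ i<pred)) ⟩
      suc (suc (pred m))               ≡⟨ cong suc (suc-pred m) ⟩
      k                                ∎) ,
    (m<n⇒0<n∸m i<pred , (λ ()) , s≤s z≤n , tt , tt) ,
    refl
    where
      i<pred : i < pred m
      i<pred = <⇒≤pred i<m

  wWindow-mid : ∀ e → e < k → WWindow (k + e)
  wWindow-mid zero _ = (c3 , k) ∷ [] ,
    spells-cong _ (λ j _ → wWord-after₁ 0 j) (prefix-spells (part ≤-refl)) ,
    +-identityʳ k , (s≤s z≤n , tt , tt) , refl
  wWindow-mid 1 _ = (c3 , m) ∷ (c2 , 1) ∷ [] ,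
    spells-cong _ (λ j _ → wWord-after₁ 1 j) (prefix-spells (whole (whole done))) ,
    +-comm m 1 , (≤-trans (s≤s z≤n) 2≤m , (λ ()) , s≤s z≤n , tt , tt) , refl
  wWindow-mid e@(suc (suc e')) (s≤s e≤m) = (c3 , k ∸ e) ∷ (c2 , 1) ∷ (c3 , suc e') ∷ [] ,
    spells-cong _ (λ j _ → trans (wWord-after₁ e j) (letterAt-drop c2 c3 e k _ j (m≤n⇒m≤1+n e≤m)))
      (prefix-spells (whole (whole (part (<⇒≤pred e≤m))))) ,
    runs-fill (m≤n⇒m≤1+n e≤m) ,
    (m<n⇒0<n∸m (s≤s e≤m) , (λ ()) , s≤s z≤n , (λ ()) , s≤s z≤n , tt , tt) ,
    refl

  wWindow-early : ∀ r → r < k → WWindow r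
  wWindow-early zero _ = (c2 , k) ∷ [] , prefix-spells (part ≤-refl) , +-identityʳ k , (s≤s z≤n , tt , tt) , refl
  wWindow-early r@(suc _) r<k = (c2 , k ∸ r) ∷ (c3 , r) ∷ [] ,
    spells-cong _ (λ j _ → letterAt-drop c2 c2 r k _ j (<⇒≤ r<k)) (prefix-spells (whole (part (<⇒≤ r<k)))) ,
    runs-fill (<⇒≤ r<k) ,
    (m<n⇒0<n∸m r<k , (λ ()) , s≤s z≤n , tt , tt) ,
    refl

  wWindow : ∀ r → r < k + k + m → WWindow r
  wWindow r r<end with r <? k
  ... | yes r<k = wWindow-early r r<k
  ... | no  r≮k with m≤n⇒∃[o]m+o≡n (≮⇒≥ r≮k)
  ...   | e , refl with e <? k
  ...     | yes e<k = wWindow-mid e e<k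
  ...     | no  e≮k with m≤n⇒∃[o]m+o≡n (≮⇒≥ e≮k)
  ...       | i , refl = wWindow-late i (+-cancelˡ-< (k + k) i m (subst (_< k + k + m) (sym (+-assoc k k i)) r<end))

  letter-W : ∀ r j → suc (m + r) + j < p → letter (n + (m + r)) j ≡ wWord (r + j)
  letter-W r j inside = begin
    letter (n + (m + r)) j           ≡⟨ letter-Cp (m + r) j ⟩
    uWord (suc (m + r) + j)          ≡⟨ cyclic-< p uLetters inside ⟩
    uLetters (suc (m + r) + j)       ≡⟨ cong uLetters (trans (cong suc (+-assoc m r j)) (sym (+-suc m (r + j)))) ⟩
    uLetters (m + suc (r + j))       ≡⟨ letterAt-skip c2 c0 m _ (suc (r + j)) ⟩
    wWord (r + j)                    ∎

  decodes-W : ∀ r → m + r + k < p → r < k + k + m → Decodes (n + (m + r))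
  decodes-W r inside r<end with wWindow r r<end
  ... | S , spells , length , normal , decoded =
    decodes-via (n + (m + r)) (λ j → wWord (r + j)) S
      (λ j j<k → letter-W r j (subst (_< p) (+-suc (m + r) j) (≤-<-trans (+-monoʳ-≤ (m + r) j<k) inside)))
      spells length normal decoded

  IsW : F4 → Set
  IsW x = x ≡ c2 ⊎ x ≡ c3

  wWord-IsW : ∀ x → IsW (wWord x)
  wWord-IsW = letterAt-All {P = IsW} c2 wRuns (inj₁ refl) (inj₁ refl ∷ inj₂ refl ∷ inj₁ refl ∷ inj₂ refl ∷ [])

  IsW⇒≢c0 : ∀ {x} → IsW x → x ≢ c0
  IsW⇒≢c0 (inj₁ refl) ()
  IsW⇒≢c0 (inj₂ refl) ()

  decode-tail : ∀ x b R c → IsW x → decode ((x , b) ∷ (R ++ (c0 , c) ∷ [])) ≡ tailBase + c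
  decode-tail x b R c isW rewrite lastRun-snoc (x , b) R (c0 , c) with isW
  ... | inj₁ refl = refl
  ... | inj₂ refl = refl

  <⇒∃ : ∀ {b c} → b < c → Σ[ a ∈ ℕ ] suc a + b ≡ c
  <⇒∃ {b} b<c with m≤n⇒∃[o]m+o≡n b<c
  ... | a , eq = a , trans (cong suc (+-comm a b)) eq

  -- A window starting at position m + r + 1 of U that passes the end of U consists of the
  -- last a + 1 letters of W followed by z + 1 letters from the start of U.
  crossing : ∀ r → suc (m + r) < p → p ≤ m + r + k →
    Σ[ a ∈ ℕ ] Σ[ z ∈ ℕ ] suc a + suc (m + r) ≡ p × suc a + suc z ≡ k
  crossing r starts ends-after with <⇒∃ starts
  ... | a , ends with <⇒∃ {suc a} {k} (+-cancelʳ-≤ (m + r) (suc (suc a)) k (≤-trans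
         (≤-reflexive (trans (sym (+-suc (suc a) (m + r))) ends))
         (≤-trans ends-after (≤-reflexive (+-comm (m + r) k)))))
  ...   | z , fills = a , z , ends , trans (+-comm (suc a) (suc z)) fills

  crossing-window : ∀ r a z → suc a + suc (m + r) ≡ p → suc a + suc z ≡ k →
    applyUpTo (letter (n + (m + r))) k ≡ applyUpTo (λ j → wWord (r + j)) (suc a) ++ replicate (suc z) c0
  crossing-window r a z ends fills = begin
    applyUpTo (letter t) k
      ≡⟨ cong (applyUpTo (letter t)) (sym fills) ⟩
    applyUpTo (letter t) (suc a + suc z)
      ≡⟨ applyUpTo-++ (letter t) (suc a) (suc z) ⟩
    applyUpTo (letter t) (suc a) ++ applyUpTo (λ j → letter t (suc a + j)) (suc z)
      ≡⟨ cong₂ _++_ (applyUpTo-cong (letter t) (λ j → wWord (r + j)) (suc a) in-W)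
                    (applyUpTo-const _ (suc z) c0 wrapped) ⟩
    applyUpTo (λ j → wWord (r + j)) (suc a) ++ replicate (suc z) c0
      ∎
    where
    t : ℕ
    t = n + (m + r)
    p≡ : suc (m + r) + suc a ≡ p
    p≡ = trans (+-comm (suc (m + r)) (suc a)) ends
    z<m : suc z ≤ m
    z<m = subst (suc z ≤_) (suc-injective fills) (m≤n+m (suc z) a)
    in-W : ∀ j → j < suc a → letter t j ≡ wWord (r + j)
    in-W j j<a = letter-W r j (subst (suc (m + r) + j <_) p≡ (+-monoʳ-< (suc (m + r)) j<a))
    wrapped : ∀ j → j < suc z → letter t (suc a + j) ≡ c0
    wrapped j j<z = begin
      letter t (suc a + j)              ≡⟨ letter-Cp (m + r) (suc a + j) ⟩
      uWord (suc (m + r) + (suc a + j)) ≡⟨ cong uWord (trans (sym (+-assoc (suc (m + r)) (suc a) j)) (cong (_+ j) p≡)) ⟩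
      uWord (p + j)                     ≡⟨ cyclic-period p uLetters j ⟩
      uWord j                           ≡⟨ cyclic-< p uLetters (<-trans (<-≤-trans j<z z<m) m<p) ⟩
      uLetters j                        ≡⟨ letterAt-run c2 c0 m _ j (<-≤-trans j<z z<m) ⟩
      c0                                ∎

  crossing-vertex : ∀ r a z → suc a + suc (m + r) ≡ p → suc a + suc z ≡ k → tailBase + suc z ≡ n + (m + r)
  crossing-vertex r a z ends fills = begin
    n + p ∸ (m + 2) + suc z                    ≡⟨ cong (λ q → n + q ∸ (m + 2) + suc z) p-split ⟩
    n + ((a + r) + (m + 2)) ∸ (m + 2) + suc z  ≡⟨ cong (λ q → q ∸ (m + 2) + suc z) (sym (+-assoc n (a + r) (m + 2))) ⟩
    n + (a + r) + (m + 2) ∸ (m + 2) + suc z    ≡⟨ cong (_+ suc z) (m+n∸n≡m (n + (a + r)) (m + 2)) ⟩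
    n + (a + r) + suc z                        ≡⟨ regroup n a r (suc z) ⟩
    n + ((a + suc z) + r)                      ≡⟨ cong (λ q → n + (q + r)) (suc-injective fills) ⟩
    n + (m + r)                                ∎
    where
    rearrange : ∀ a m r → suc a + suc (m + r) ≡ (a + r) + (m + 2)
    rearrange = solve-∀
    regroup : ∀ n a r z → n + (a + r) + z ≡ n + ((a + z) + r)
    regroup = solve-∀
    p-split : p ≡ (a + r) + (m + 2)
    p-split = trans (sym ends) (rearrange a m r)

  decodes-tail : ∀ r a z → suc a + suc (m + r) ≡ p → suc a + suc z ≡ k → Decodes (n + (m + r))
  decodes-tail r a z ends fills with rle-head (wWord (r + 0)) (applyUpTo (λ j → wWord (r + suc j)) a)
  ... | b , R , rle-W = begin
    decode (rle (applyUpTo (letter (n + (m + r))) k))              ≡⟨ cong (decode ∘′ rle) (crossing-window r a z ends fills) ⟩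
    decode (rle (applyUpTo w (suc a) ++ replicate (suc z) c0))     ≡⟨ cong decode (rle-append _ z c0 W≢c0) ⟩
    decode (rle (applyUpTo w (suc a)) ++ (c0 , suc z) ∷ [])        ≡⟨ cong (λ R → decode (R ++ (c0 , suc z) ∷ [])) rle-W ⟩
    decode ((w 0 , suc b) ∷ (R ++ (c0 , suc z) ∷ []))              ≡⟨ decode-tail (w 0) (suc b) R (suc z) (wWord-IsW (r + 0)) ⟩
    tailBase + suc z                                               ≡⟨ crossing-vertex r a z ends fills ⟩
    n + (m + r)                                                    ∎
    where
    w : ℕ → F4
    w j = wWord (r + j)
    W≢c0 : All (_≢ c0) (applyUpTo w (suc a))
    W≢c0 = applyUpTo⁺₁ w (suc a) (λ {j} _ → IsW⇒≢c0 (wWord-IsW (r + j)))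

  -- The vertices n + s of C_p.  The bound p ≤ 5m + 3 keeps every window lying inside W away
  -- from the final block of 2s of W.
  decodes-Cp : p ≤ m + (k + k + m) + k → ∀ s → suc s < p → Decodes (n + s)
  decodes-Cp p≤ s s+1<p with suc s <? m
  ... | yes s+1<m = decodes-U₀ s s+1<m
  ... | no  s+1≮m with suc s ≟ m
  ...   | yes s+1≡m = decodes-U₁ s s+1≡m
  ...   | no  s+1≢m with m≤n⇒∃[o]m+o≡n (≤-pred (≤∧≢⇒< (≮⇒≥ s+1≮m) (≢-sym s+1≢m)))
  ...     | r , refl with m + r + k <? p
  ...       | yes inside = decodes-W r inside
                 (+-cancelˡ-< m r (k + k + m) (+-cancelʳ-< k (m + r) (m + (k + k + m)) (<-≤-trans inside p≤)))
  ...       | no  ¬inside with crossing r s+1<p (≮⇒≥ ¬inside)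
  ...         | a , z , ends , fills = decodes-tail r a z ends fills

  data Vertex : ℕ → Set where
    A₀ : ∀ t → t < m → Vertex t
    A₁ : ∀ d → d < m → Vertex (m + d)
    Cp : ∀ s → Vertex (n + s)

  vertex : ∀ t → Vertex t
  vertex t with t <? m
  ... | yes t<m = A₀ t t<m
  ... | no  t≮m with m≤n⇒∃[o]m+o≡n (≮⇒≥ t≮m)
  ...   | d , refl with d <? m
  ...     | yes d<m = A₁ d d<m
  ...     | no  d≮m with m≤n⇒∃[o]m+o≡n (≮⇒≥ d≮m)
  ...       | s , refl = subst Vertex (+-assoc m m s) (Cp s)

  -- Every vertex of C_n · C_p decodes, provided p ≤ 5m + 3 (written m + (k + k + m) + k).
  decodes : p ≤ m + (k + k + m) + k → ∀ t → t < n + p ∸ 1 → Decodes t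
  decodes p≤ t t<N with vertex t
  ... | A₀ t t<m = decodes-A₀ t t<m
  ... | A₁ d d<m = decodes-A₁ d d<m
  ... | Cp s     = decodes-Cp p≤ s (subst (suc (suc s) ≤_) (m+[n∸m]≡n 1≤p)
                     (s≤s (+-cancelˡ-< n s (p ∸ 1) (subst (n + s <_) (+-∸-assoc n 1≤p) t<N))))
    where
    1≤p : 1 ≤ p
    1≤p = ≤-<-trans z≤n m<p

  labeling : p ≤ m + (k + k + m) + k → QuasiLabeling 4 m (infinityDigraph n p)
  labeling p≤ = windowLabeling (infinityDigraph n p) letter (decode ∘′ rle)
    (λ x y → shift (toℕ x) (toℕ y))
    (λ x → decodes p≤ (toℕ x) (toℕ<n x))

-- With n = 2m: 4 ≤ n gives m ≥ 2, and 2p ≤ 5n + 6 gives p ≤ 5m + 3.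
theorem5 : (n p : ℕ) → 4 ≤ n → 2 ∣ n → n ≤ p → 2 * p ≤ 5 * n + 6 →
    QuasiLabeling 4 (n / 2) (infinityDigraph n p)
theorem5 .(m * 2) p 4≤n (divides m refl) n≤p p-bound =
  subst₂ (λ a b → QuasiLabeling 4 a (infinityDigraph b p)) (sym (m*n/n≡m m 2)) (sym (twice m))
    (Construction.labeling m p 2≤m (subst (_≤ p) (twice m) n≤p) p≤5m+3)
  where
  twice : ∀ m → m * 2 ≡ m + m
  twice = solve-∀
  2≤m : 2 ≤ m
  2≤m = *-cancelʳ-≤ 2 m 2 4≤n
  ten : ∀ m → 5 * (m * 2) + 6 ≡ 2 * (m + (suc m + suc m + m) + suc m)
  ten = solve-∀
  p≤5m+3 : p ≤ m + (suc m + suc m + m) + suc m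
  p≤5m+3 = *-cancelˡ-≤ 2 (subst (2 * p ≤_) (ten m) p-bound)
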